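{- Let $G$ be a finite simple graph, let $D=\operatorname{Dist}(G)$ and $F=\operatorname{Dist}_f(G)$. Then $$\rho^D(G)\ge \rho^{D+1}(G)\ge\cdots\ge \rho^{F-1}(G)\ge \rho^F(G)=\rho^{F+1}(G)=\cdots=\det(G),$$ i.e. $\rho^d(G)$ is nonincreasing in $d$ for $d\ge D$, and $\rho^d(G)=\det(G)$ for every $d\ge F$.
   Context: A $d$-distinguishing coloring of $G$ is an assignment of colors from a set of $d$ colors to the vertices such that the only automorphism of $G$ mapping each color class to itself is the identity; $G$ is $d$-distinguishable if such a coloring exists. $\operatorname{Dist}(G)$ is the least $d$ for which $G$ is $d$-distinguishable. The paint cost $\rho^d(G)$ (for $d\ge \operatorname{Dist}(G)$) is the minimum of $|V(G)\setminus T|$ over all $d$-distinguishing colorings and all their color classes $T$. A determining set is a set $S\subseteq V(G)$ such that only the identity automorphism fixes every vertex of $S$; $\det(G)$ is the minimum size of a determining set. The frugal distinguishing number $\operatorname{Dist}_f(G)$ is the smallest $d$ for which $\rho^d(G)=\det(G)$. -}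

module Defs where

open import Data.Nat using (ℕ; _<_; _≤_)
open import Data.Bool using (Bool; true; false)
open import Data.Fin using (Fin)
open import Data.Fin.Properties using (_≟_)
open import Data.Fin.Subset using (Subset; _∈_; ∣_∣)
open import Data.List using (List; length; filter)
open import Data.List.Base using () renaming (allFin to allFinL)
open import Data.Product using (Σ; ∃; _×_; _,_)
open import Function.Bundles using (Inverse; _↔_)
open import Relation.Binary.PropositionalEquality using (_≡_; _≢_)
open import Relation.Nullary using (¬_)
open import Relation.Nullary.Decidable using (¬?)

record Graph : Set where
  field
    n     : ℕ
    adj   : Fin n → Fin n → Bool
    sym   : ∀ u v → adj u v ≡ adj v u
    irrefl : ∀ v → adj v v ≡ false
open Graph public

record Automorphism (G : Graph) : Set where
  field
    perm     : Fin (n G) ↔ Fin (n G)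
    preserves : ∀ u v → adj G (Inverse.to perm u) (Inverse.to perm v) ≡ adj G u v
open Automorphism public

app : {G : Graph} → Automorphism G → Fin (n G) → Fin (n G)
app σ = Inverse.to (perm σ)

IsIdentity : {G : Graph} → Automorphism G → Set
IsIdentity {G} σ = ∀ v → app σ v ≡ v

Coloring : Graph → ℕ → Set
Coloring G d = Fin (n G) → Fin d

PreservesColoring : {G : Graph} {d : ℕ} → Automorphism G → Coloring G d → Set
PreservesColoring σ c = ∀ v → c (app σ v) ≡ c v

IsDistinguishing : (G : Graph) (d : ℕ) → Coloring G d → Set
IsDistinguishing G d c = (σ : Automorphism G) → PreservesColoring σ c → IsIdentity σ

Distinguishable : Graph → ℕ → Set
Distinguishable G d = Σ (Coloring G d) (IsDistinguishing G d)

IsDist : Graph → ℕ → Set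
IsDist G D = Distinguishable G D × (∀ d → d < D → ¬ Distinguishable G d)

complementSize : {G : Graph} {d : ℕ} → Coloring G d → Fin d → ℕ
complementSize {G} c i = length (filter (λ v → ¬? (c v ≟ i)) (allFinL (n G)))

-- k = ρ^d(G): minimum of |V \ T| over all d-distinguishing colorings c and their colour classes T
IsPaintCost : Graph → ℕ → ℕ → Set
IsPaintCost G d k =
  (Σ (Coloring G d) λ c → IsDistinguishing G d c × Σ (Fin d) λ i → complementSize {G} {d} c i ≡ k)
  × (∀ (c : Coloring G d) → IsDistinguishing G d c → ∀ (i : Fin d) → k ≤ complementSize {G} {d} c i)

IsDetermining : (G : Graph) → Subset (n G) → Set
IsDetermining G S = (σ : Automorphism G) → (∀ v → v ∈ S → app σ v ≡ v) → IsIdentity σ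

IsDet : Graph → ℕ → Set
IsDet G k =
  (Σ (Subset (n G)) λ S → IsDetermining G S × ∣ S ∣ ≡ k)
  × (∀ S → IsDetermining G S → k ≤ ∣ S ∣)

PaintCostIsDet : Graph → ℕ → Set
PaintCostIsDet G d = ∃ λ k → IsDet G k × IsPaintCost G d k

IsDistF : Graph → ℕ → Set
IsDistF G F = PaintCostIsDet G F × (∀ d → d < F → ¬ PaintCostIsDet G d)

{-# OPTIONS --safe #-}
module Submission where

open import Defs hiding (sym)
open import Data.Nat using (ℕ; suc; _≤_; _<_)
open import Data.Product using (Σ; _×_; _,_; ∃; ∃₂)
open import Data.Nat.Properties using (≤-antisym; n≤1+n; ≮⇒≥; anyUpTo?) renaming (_≟_ to _≟ℕ_)
open import Data.Nat.Induction using (<-rec)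
open import Data.Fin using (Fin; inject≤) renaming (zero to fzero; suc to fsuc)
open import Data.Fin.Properties using (_≟_; any?; all?; inject≤-injective)
open import Data.Fin.Subset using (Subset; ∣_∣) renaming (_∈_ to _∈ₛ_)
open import Data.Bool.Properties using () renaming (_≟_ to _≟ᵇ_)
open import Data.List using (length; filter)
import Data.List as List
import Data.Vec as Vec
open import Data.Vec.Properties using (lookup∘tabulate; lookup⇒[]=)
open import Data.Vec.Functional using (_∷_; head; tail)
open import Data.List.Properties using (filter-≐)
open import Function using (_∘_; Injective)
open import Function.Bundles using (Inverse; Injection; Equivalence; _⇔_; mk⇔; mk↔ₛ′)
open import Function.Properties.Inverse using (↔⇒↣)
open import Level using (Level)
open import Relation.Binary.PropositionalEquality
  using (_≡_; _≗_; refl; sym; trans; cong; cong₂; subst)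
open import Relation.Nullary using (Dec; yes; no; ¬_; does; contradiction)
open import Relation.Nullary.Decidable using (map′; ¬?; _×-dec_; dec-true; decidable-stable)
open import Relation.Unary using (Pred; Decidable)

-- Every d-distinguishing colouring stays distinguishing, with the same colour
-- classes, when viewed as a (d+1)- or (d+k)-colouring; so the set of values
-- |V \ T| realised at d colours grows with d and its minimum ρ^d can only drop.
-- For the lower bound, the complement of any colour class T of a distinguishing
-- colouring is a determining set: an automorphism fixing V \ T pointwise maps T
-- onto itself.  Hence ρ^d ≥ det(G) whenever ρ^d exists, and ρ^F = det(G) carries
-- over to every d ≥ F.  Since ρ^d is a minimum, its existence needs a search over
-- all colourings and automorphisms, which is finite and hence decidable.

private
  variable
    ℓ : Level

least-satisfier : {P : Pred ℕ ℓ} → Decidable P →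
  ∀ a → P a → ∃ λ k → P k × (∀ j → P j → k ≤ j)
least-satisfier {P = P} P? = <-rec _ step
  where
  step : ∀ a → (∀ {b} → b < a → P b → ∃ λ k → P k × (∀ j → P j → k ≤ j)) →
    P a → ∃ λ k → P k × (∀ j → P j → k ≤ j)
  step a smaller pa with anyUpTo? P? a
  ... | yes (b , b<a , pb) = smaller b<a pb
  ... | no none = a , pa , λ j pj → ≮⇒≥ (λ j<a → none (j , j<a , pj))

Respects≗ : ∀ {n m} → Pred (Fin n → Fin m) ℓ → Set ℓ
Respects≗ P = ∀ {f g} → f ≗ g → P f → P g

∃-function? : ∀ {n m} {P : Pred (Fin n → Fin m) ℓ} → Respects≗ P → Decidable P → Dec (∃ P)
∃-function? {n = 0} resp P? =
  map′ (λ p → _ , p) (λ (f , p) → resp (λ ()) p) (P? (λ ()))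
∃-function? {n = suc _} {P = P} resp P? =
  map′ (λ (a , f , p) → a ∷ f , p) (λ (f , p) → head f , tail f , resp (head∷tail f) p)
    (any? λ a → ∃-function? (resp ∘ ∷-cong a) (P? ∘ (a ∷_)))
  where
  ∷-cong : ∀ {n m} (a : Fin m) {f g : Fin n → Fin m} → f ≗ g → (a ∷ f) ≗ (a ∷ g)
  ∷-cong a f≗g fzero    = refl
  ∷-cong a f≗g (fsuc x) = f≗g x
  head∷tail : ∀ {n m} (f : Fin (suc n) → Fin m) → f ≗ (head f ∷ tail f)
  head∷tail f fzero    = refl
  head∷tail f (fsuc x) = refl

length-filter-tabulate : ∀ {A : Set} {m} {P : Pred A ℓ} (P? : Decidable P) (g : Fin m → A) →
  length (filter P? (List.tabulate g)) ≡ ∣ Vec.tabulate (does ∘ P? ∘ g) ∣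
length-filter-tabulate {m = 0}     P? g = refl
length-filter-tabulate {m = suc _} P? g with P? (g fzero)
... | yes _ = cong suc (length-filter-tabulate P? (g ∘ fsuc))
... | no _  = length-filter-tabulate P? (g ∘ fsuc)

∈-tabulate-does : ∀ {m} {P : Pred (Fin m) ℓ} (P? : Decidable P) {v} →
  P v → v ∈ₛ Vec.tabulate (does ∘ P?)
∈-tabulate-does P? {v} pv = lookup⇒[]= v _ (trans (lookup∘tabulate (does ∘ P?) v) (dec-true (P? v) pv))

module _ (G : Graph) where

  private
    V : Set
    V = Fin (n G)

  complementSize-cong : ∀ {d d′} {c : Coloring G d} {c′ : Coloring G d′} {i i′} →
    (∀ v → (c v ≡ i) ⇔ (c′ v ≡ i′)) → complementSize {G} c i ≡ complementSize {G} c′ i′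
  complementSize-cong {c = c} {c′} {i} {i′} same =
    cong length (filter-≐ (λ v → ¬? (c v ≟ i)) (λ v → ¬? (c′ v ≟ i′))
      ((λ {v} ne → ne ∘ Equivalence.from (same v)) , (λ {v} ne → ne ∘ Equivalence.to (same v)))
      (List.allFin (n G)))

  complementSize-recolour : ∀ {d d′} {e : Fin d → Fin d′} → Injective _≡_ _≡_ e →
    (c : Coloring G d) (i : Fin d) → complementSize {G} (e ∘ c) (e i) ≡ complementSize {G} c i
  complementSize-recolour {e = e} e-inj c i = complementSize-cong (λ v → mk⇔ e-inj (cong e))

  isDistinguishing-recolour : ∀ {d d′} {e : Fin d → Fin d′} → Injective _≡_ _≡_ e →
    {c : Coloring G d} → IsDistinguishing G d c → IsDistinguishing G d′ (e ∘ c)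
  isDistinguishing-recolour e-inj dc σ σ-fixes-colours = dc σ (e-inj ∘ σ-fixes-colours)

  isDistinguishing-cong : ∀ {d} {c c′ : Coloring G d} → c ≗ c′ →
    IsDistinguishing G d c → IsDistinguishing G d c′
  isDistinguishing-cong c≗c′ dc σ σ-fixes-colours =
    dc σ (λ v → trans (c≗c′ (app σ v)) (trans (σ-fixes-colours v) (sym (c≗c′ v))))

  -- An automorphism is searched for as a pair of mutually inverse maps.
  MovingColourAutomorphism : ∀ {d} → Coloring G d → (V → V) → (V → V) → Set
  MovingColourAutomorphism c f g =
    (∀ y → f (g y) ≡ y) × (∀ x → g (f x) ≡ x) × (∀ u v → adj G (f u) (f v) ≡ adj G u v) ×
    (∀ v → c (f v) ≡ c v) × ¬ (∀ v → f v ≡ v)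

  isDistinguishing⇔ : ∀ {d} (c : Coloring G d) →
    IsDistinguishing G d c ⇔ (¬ ∃₂ (MovingColourAutomorphism c))
  isDistinguishing⇔ c = mk⇔
    (λ dc (f , g , fg , gf , adj-f , c-f , moves) →
      moves (dc (record { perm = mk↔ₛ′ f g fg gf ; preserves = adj-f }) c-f))
    (λ none σ c-σ → decidable-stable (all? (λ v → app σ v ≟ v)) λ moves →
      none (app σ , Inverse.from (perm σ) , Inverse.strictlyInverseˡ (perm σ) ,
            Inverse.strictlyInverseʳ (perm σ) , preserves σ , c-σ , moves))

  isDistinguishing? : ∀ {d} (c : Coloring G d) → Dec (IsDistinguishing G d c)
  isDistinguishing? c = map′ (Equivalence.from (isDistinguishing⇔ c)) (Equivalence.to (isDistinguishing⇔ c))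
    (¬? (∃-function? respects-f λ f → ∃-function? (respects-g f) (moving? f)))
    where
    moving? : ∀ f g → Dec (MovingColourAutomorphism c f g)
    moving? f g =
      all? (λ y → f (g y) ≟ y) ×-dec all? (λ x → g (f x) ≟ x) ×-dec
      all? (λ u → all? λ v → adj G (f u) (f v) ≟ᵇ adj G u v) ×-dec
      all? (λ v → c (f v) ≟ c v) ×-dec ¬? (all? λ v → f v ≟ v)
    respects-g : ∀ f → Respects≗ (MovingColourAutomorphism c f)
    respects-g f g≗g′ (fg , gf , adj-f , c-f , moves) =
      (λ y → trans (cong f (sym (g≗g′ y))) (fg y)) , (λ x → trans (sym (g≗g′ (f x))) (gf x)) ,
      adj-f , c-f , moves
    respects-f : Respects≗ (λ f → ∃ (MovingColourAutomorphism c f))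
    respects-f f≗f′ (g , fg , gf , adj-f , c-f , moves) =
      g , (λ y → trans (sym (f≗f′ (g y))) (fg y)) , (λ x → trans (cong g (sym (f≗f′ x))) (gf x)) ,
      (λ u v → trans (cong₂ (adj G) (sym (f≗f′ u)) (sym (f≗f′ v))) (adj-f u v)) ,
      (λ v → trans (cong c (sym (f≗f′ v))) (c-f v)) , (λ fixes → moves (λ v → trans (f≗f′ v) (fixes v)))

  RealisedCost : ℕ → ℕ → Set
  RealisedCost d k =
    Σ (Coloring G d) λ c → IsDistinguishing G d c × Σ (Fin d) λ i → complementSize {G} c i ≡ k

  realisedCost? : ∀ d k → Dec (RealisedCost d k)
  realisedCost? d k =
    ∃-function? respects (λ c → isDistinguishing? c ×-dec any? λ i → complementSize {G} c i ≟ℕ k)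
    where
    respects : Respects≗ (λ c → IsDistinguishing G d c × Σ (Fin d) λ i → complementSize {G} c i ≡ k)
    respects c≗c′ (dc , i , size≡k) =
      isDistinguishing-cong c≗c′ dc , i ,
      trans (complementSize-cong (λ v → mk⇔ (trans (c≗c′ v)) (trans (sym (c≗c′ v))))) size≡k

  realisedCost-mono : ∀ {d d′ k} → d ≤ d′ → RealisedCost d k → RealisedCost d′ k
  realisedCost-mono {d} {d′} d≤d′ (c , dc , i , size≡k) =
    embed ∘ c , isDistinguishing-recolour embed-injective dc , embed i ,
    trans (complementSize-recolour embed-injective c i) size≡k
    where
    embed : Fin d → Fin d′
    embed x = inject≤ x d≤d′
    embed-injective : Injective _≡_ _≡_ embed
    embed-injective = inject≤-injective d≤d′ d≤d′ _ _

  paintCost-≤ : ∀ {d a} → RealisedCost d a → ∃ λ b → IsPaintCost G d b × b ≤ a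
  paintCost-≤ {d} {a} realised with least-satisfier (realisedCost? d) a realised
  ... | b , realised-b , minimal =
    b , (realised-b , λ c dc i → minimal _ (c , dc , i , refl)) , minimal a realised

  colourClassComplement : ∀ {d} → Coloring G d → Fin d → Subset (n G)
  colourClassComplement c i = Vec.tabulate (does ∘ λ v → ¬? (c v ≟ i))

  colourClassComplement-determining : ∀ {d} {c : Coloring G d} → IsDistinguishing G d c →
    ∀ i → IsDetermining G (colourClassComplement c i)
  colourClassComplement-determining {c = c} dc i σ fixes = dc σ colours-fixed
    where
    fixed : ∀ {v} → ¬ c v ≡ i → app σ v ≡ v
    fixed ne = fixes _ (∈-tabulate-does (λ v → ¬? (c v ≟ i)) ne)
    colours-fixed : ∀ v → c (app σ v) ≡ c v
    colours-fixed v with c v ≟ i | c (app σ v) ≟ i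
    ... | no cv≢i  | _         = cong c (fixed cv≢i)
    ... | yes cv≡i | yes cσv≡i = trans cσv≡i (sym cv≡i)
    ... | yes cv≡i | no cσv≢i  = contradiction (trans (cong c σv≡v) cv≡i) cσv≢i
      where
      σv≡v : app σ v ≡ v
      σv≡v = Injection.injective (↔⇒↣ (perm σ)) (fixed cσv≢i)

  det≤complementSize : ∀ {k d} {c : Coloring G d} → IsDet G k → IsDistinguishing G d c →
    ∀ i → k ≤ complementSize {G} c i
  det≤complementSize {c = c} (_ , minimal) dc i =
    subst (_ ≤_) (sym (length-filter-tabulate (λ v → ¬? (c v ≟ i)) (λ v → v)))
      (minimal _ (colourClassComplement-determining dc i))

  det-unique : ∀ {k k′} → IsDet G k → IsDet G k′ → k ≡ k′
  det-unique ((S , detS , ∣S∣≡k) , minimal) ((S′ , detS′ , ∣S′∣≡k′) , minimal′) =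
    ≤-antisym (subst (_ ≤_) ∣S′∣≡k′ (minimal S′ detS′)) (subst (_ ≤_) ∣S∣≡k (minimal′ S detS))

mainTheorem4 : (G : Graph) (D F : ℕ) → IsDist G D → IsDistF G F →
    ((d : ℕ) → D ≤ d → (a : ℕ) → IsPaintCost G d a →
      Σ ℕ (λ b → IsPaintCost G (suc d) b × b ≤ a))
    × ((d : ℕ) → F ≤ d → (k : ℕ) → IsDet G k → IsPaintCost G d k)
mainTheorem4 G D F _ ((k₀ , det-k₀ , (realised-F , _)) , _) = nonincreasing , stable
  where
  nonincreasing : (d : ℕ) → D ≤ d → (a : ℕ) → IsPaintCost G d a →
    Σ ℕ (λ b → IsPaintCost G (suc d) b × b ≤ a)
  nonincreasing d _ a (realised , _) = paintCost-≤ G (realisedCost-mono G (n≤1+n d) realised)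

  stable : (d : ℕ) → F ≤ d → (k : ℕ) → IsDet G k → IsPaintCost G d k
  stable d F≤d k det-k rewrite det-unique G det-k det-k₀ =
    realisedCost-mono G F≤d realised-F , λ c dc i → det≤complementSize G det-k₀ dc i
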